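{- Let $r\ge 3$ and let $\mathcal{H}=(\mathcal{V},\mathcal{E})$ be an $r$-uniform bi-hypergraph with $|\mathcal{V}|=2r$. If $|\mathcal{E}|<\binom{2r}{r}/2$, then $\mathcal{H}$ is colorable.
   Context: A bi-hypergraph is a pair $\mathcal{H}=(\mathcal{V},\mathcal{E})$ with $\mathcal{V}$ a finite set and $\mathcal{E}$ a Sperner family of subsets of $\mathcal{V}$ (edges); it is $r$-uniform if all edges have size $r$. A proper coloring is a map $f:\mathcal{V}\to\mathbb{N}$ with $1<|\{f(v):v\in e\}|<|e|$ for every edge $e$; $\mathcal{H}$ is colorable if such $f$ exists. -}

module Defs where

open import Data.Nat using (ℕ; _<_; _*_)
import Data.Nat as ℕ
open import Data.Fin using (Fin)
open import Data.Fin.Subset using (Subset; _⊆_; _∈_; ∣_∣)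
open import Data.Fin.Subset.Properties using (_∈?_)
open import Data.List using (List; length; map; filter; deduplicate; allFin)
open import Data.List.Relation.Unary.All using (All)
open import Data.List.Relation.Unary.Unique.Propositional using (Unique)
import Data.List.Membership.Propositional as L
open import Data.Product using (_×_)
open import Relation.Binary.PropositionalEquality using (_≡_; _≢_)
open import Relation.Nullary using (¬_)

record BiHypergraph (n : ℕ) : Set where
  field
    edges   : List (Subset n)
    unique  : Unique edges
    sperner : ∀ {e f} → e L.∈ edges → f L.∈ edges → e ≢ f → ¬ (e ⊆ f)
open BiHypergraph public

numEdges : ∀ {n} → BiHypergraph n → ℕ
numEdges H = length (edges H)

Uniform : ∀ {n} → ℕ → BiHypergraph n → Set
Uniform r H = All (λ e → ∣ e ∣ ≡ r) (edges H)

elems : ∀ {n} → Subset n → List (Fin n)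
elems e = filter (_∈? e) (allFin _)

numColors : ∀ {n} → (Fin n → ℕ) → Subset n → ℕ
numColors f e = length (deduplicate ℕ._≟_ (map f (elems e)))

ProperColoring : ∀ {n} → BiHypergraph n → (Fin n → ℕ) → Set
ProperColoring H f = All (λ e → (1 < numColors f e) × (numColors f e < ∣ e ∣)) (edges H)

Colorable : ∀ {n} → BiHypergraph n → Set
Colorable {n} H = Data.Product.Σ (Fin n → ℕ) (ProperColoring H)

-- The r-subsets of a 2r-set fall into C(2r,r)/2 complementary pairs, and
-- an r-uniform family with fewer than C(2r,r)/2 edges leaves some pair {A, ∁ A} with
-- neither set an edge. Colour A with 0 and ∁ A with 1. An edge e of size r = |A| = |∁ A|
-- which is neither A nor ∁ A is contained in neither, so e sees both colours: 2 colours,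
-- and 1 < 2 < r since r ≥ 3.
module Submission where

open import Defs
open import Data.Nat using (ℕ; zero; suc; _≟_; _+_; _*_; _∸_; _≤_; _<_; z≤n; s≤s)
open import Data.Nat.Properties
  using (≤-antisym; <-irrefl; ≤⇒≯; m+n∸m≡n; +-identityʳ; *-comm; module ≤-Reasoning)
open import Data.Nat.Combinatorics using (_C_; nCk+nC[k+1]≡[n+1]C[k+1])
import Data.Bool as Bool
open import Data.Fin using (Fin)
import Data.Fin.Properties as Fin
open import Data.Fin.Subset using (Subset; _⊆_; ∁; inside; outside; ∣_∣)
  renaming (_∈_ to _∈ₛ_; _∉_ to _∉ₛ_)
open import Data.Fin.Subset.Properties
  using (_∈?_; ⊆-antisym; p⊂q⇒∣p∣<∣q∣; x∉∁p⇒x∈p; ∣∁p∣≡n∸∣p∣; ∪-∩-booleanAlgebra)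
open import Data.Vec using ([]; _∷_)
open import Data.Vec.Properties using (≡-dec; ∷-injectiveʳ)
open import Data.List using (List; []; _∷_; length; map; _++_; allFin; deduplicate)
open import Data.List.Properties using (length-++; length-map; length-removeAt′)
open import Data.List.Membership.Propositional using (_∈_; _∉_; find; lose)
open import Data.List.Membership.Propositional.Properties
  using (∈-map⁺; ∈-map⁻; ∈-++⁺ˡ; ∈-++⁺ʳ; ∈-++⁻; ∈-filter⁺; ∈-filter⁻; ∈-allFin;
         ∈-deduplicate⁺; ∈-deduplicate⁻)
import Data.List.Membership.DecPropositional as DecMembership
open import Data.List.Relation.Binary.Subset.Propositional using () renaming (_⊆_ to _⊆ₗ_)
open import Data.List.Relation.Unary.Any using (here; there; index; _─_; any?)
open import Data.List.Relation.Unary.All as All using (All)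
open import Data.List.Relation.Unary.AllPairs using ([]; _∷_)
open import Data.List.Relation.Unary.Unique.Propositional using (Unique)
import Data.List.Relation.Unary.Unique.Propositional.Properties as Unique
open import Data.List.Relation.Unary.Unique.DecPropositional.Properties _≟_
  using (deduplicate-!)
open import Data.Product using (∃; _×_; _,_; proj₂)
open import Data.Sum using (inj₁; inj₂)
open import Data.Empty using (⊥)
open import Relation.Nullary using (Dec; yes; no; contradiction)
open import Relation.Nullary.Decidable using (_×-dec_; ¬?; decidable-stable)
open import Relation.Binary.PropositionalEquality

module _ {a} {A : Set a} where

  ∈-─⁺ : ∀ {x y : A} {ys} (x∈ys : x ∈ ys) → y ∈ ys → y ≢ x → y ∈ (ys ─ x∈ys)
  ∈-─⁺ (here refl) (here refl) y≢x = contradiction refl y≢x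
  ∈-─⁺ (here _)    (there y∈ys) _  = y∈ys
  ∈-─⁺ (there _)   (here y≡z)  _   = here y≡z
  ∈-─⁺ (there x∈ys) (there y∈ys) y≢x = there (∈-─⁺ x∈ys y∈ys y≢x)

  Unique∧⊆⇒length≤ : ∀ {xs ys : List A} → Unique xs → xs ⊆ₗ ys → length xs ≤ length ys
  Unique∧⊆⇒length≤ {[]}     _             _     = z≤n
  Unique∧⊆⇒length≤ {x ∷ xs} {ys} (x∉xs ∷ u) xs⊆ys = begin
    suc (length xs)          ≤⟨ s≤s (Unique∧⊆⇒length≤ u xs⊆ys─x) ⟩
    suc (length (ys ─ x∈ys)) ≡⟨ length-removeAt′ ys (index x∈ys) ⟨
    length ys                ∎
    where
    open ≤-Reasoning
    x∈ys : x ∈ ys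
    x∈ys = xs⊆ys (here refl)
    xs⊆ys─x : xs ⊆ₗ (ys ─ x∈ys)
    xs⊆ys─x z∈xs = ∈-─⁺ x∈ys (xs⊆ys (there z∈xs)) (≢-sym (All.lookup x∉xs z∈xs))

  Unique∧⊆∧⊇⇒length≡ : ∀ {xs ys : List A} → Unique xs → Unique ys →
                        xs ⊆ₗ ys → ys ⊆ₗ xs → length xs ≡ length ys
  Unique∧⊆∧⊇⇒length≡ uxs uys xs⊆ys ys⊆xs =
    ≤-antisym (Unique∧⊆⇒length≤ uxs xs⊆ys) (Unique∧⊆⇒length≤ uys ys⊆xs)

subsetsOfSize : (n k : ℕ) → List (Subset n)
subsetsOfSize zero    zero    = [] ∷ []
subsetsOfSize zero    (suc k) = []
subsetsOfSize (suc n) zero    = map (outside ∷_) (subsetsOfSize n zero)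
subsetsOfSize (suc n) (suc k) =
  map (inside ∷_) (subsetsOfSize n k) ++ map (outside ∷_) (subsetsOfSize n (suc k))

length-subsetsOfSize : ∀ n k → length (subsetsOfSize n k) ≡ n C k
length-subsetsOfSize zero    zero    = refl
length-subsetsOfSize zero    (suc k) = refl
length-subsetsOfSize (suc n) zero    =
  trans (length-map (outside ∷_) (subsetsOfSize n zero)) (length-subsetsOfSize n zero)
length-subsetsOfSize (suc n) (suc k) = begin
  length (map (inside ∷_) Sₖ ++ map (outside ∷_) Sₖ₊₁)
    ≡⟨ length-++ (map (inside ∷_) Sₖ) ⟩
  length (map (inside ∷_) Sₖ) + length (map (outside ∷_) Sₖ₊₁)
    ≡⟨ cong₂ _+_ (length-map (inside ∷_) Sₖ) (length-map (outside ∷_) Sₖ₊₁) ⟩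
  length Sₖ + length Sₖ₊₁
    ≡⟨ cong₂ _+_ (length-subsetsOfSize n k) (length-subsetsOfSize n (suc k)) ⟩
  n C k + n C suc k
    ≡⟨ nCk+nC[k+1]≡[n+1]C[k+1] n k ⟩
  suc n C suc k ∎
  where
  open ≡-Reasoning
  Sₖ = subsetsOfSize n k
  Sₖ₊₁ = subsetsOfSize n (suc k)

subsetsOfSize-unique : ∀ n k → Unique (subsetsOfSize n k)
subsetsOfSize-unique zero    zero    = All.[] ∷ []
subsetsOfSize-unique zero    (suc k) = []
subsetsOfSize-unique (suc n) zero    = Unique.map⁺ ∷-injectiveʳ (subsetsOfSize-unique n zero)
subsetsOfSize-unique (suc n) (suc k) =
  Unique.++⁺ (Unique.map⁺ ∷-injectiveʳ (subsetsOfSize-unique n k))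
             (Unique.map⁺ ∷-injectiveʳ (subsetsOfSize-unique n (suc k)))
             disjoint
  where
  disjoint : ∀ {p} → p ∈ map (inside ∷_) (subsetsOfSize n k) ×
                     p ∈ map (outside ∷_) (subsetsOfSize n (suc k)) → ⊥
  disjoint (p∈ins , p∈outs) with ∈-map⁻ (inside ∷_) p∈ins | ∈-map⁻ (outside ∷_) p∈outs
  ... | _ , _ , refl | _ , _ , ()

∈-subsetsOfSize⇒∣p∣≡k : ∀ n k {p} → p ∈ subsetsOfSize n k → ∣ p ∣ ≡ k
∈-subsetsOfSize⇒∣p∣≡k zero    zero    (here refl) = refl
∈-subsetsOfSize⇒∣p∣≡k (suc n) zero    p∈S with ∈-map⁻ (outside ∷_) p∈S
... | _ , q∈S , refl = ∈-subsetsOfSize⇒∣p∣≡k n zero q∈S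
∈-subsetsOfSize⇒∣p∣≡k (suc n) (suc k) p∈S with ∈-++⁻ (map (inside ∷_) (subsetsOfSize n k)) p∈S
... | inj₁ p∈ins with ∈-map⁻ (inside ∷_) p∈ins
...   | _ , q∈S , refl = cong suc (∈-subsetsOfSize⇒∣p∣≡k n k q∈S)
∈-subsetsOfSize⇒∣p∣≡k (suc n) (suc k) p∈S | inj₂ p∈outs with ∈-map⁻ (outside ∷_) p∈outs
...   | _ , q∈S , refl = ∈-subsetsOfSize⇒∣p∣≡k n (suc k) q∈S

_∈ˢ?_ : ∀ {n} (A : Subset n) (E : List (Subset n)) → Dec (A ∈ E)
_∈ˢ?_ = DecMembership._∈?_ (≡-dec Bool._≟_)

∃-complementary-pair-∉ : ∀ {n} k (E : List (Subset n)) → length E * 2 < n C k →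
                          ∃ λ A → ∣ A ∣ ≡ k × A ∉ E × ∁ A ∉ E
∃-complementary-pair-∉ {n} k E fewEdges
  with any? (λ A → ¬? (A ∈ˢ? E) ×-dec ¬? (∁ A ∈ˢ? E)) (subsetsOfSize n k)
... | yes found with A , A∈S , A∉E , ∁A∉E ← find found =
  A , ∈-subsetsOfSize⇒∣p∣≡k n k A∈S , A∉E , ∁A∉E
... | no none = contradiction fewEdges (≤⇒≯ pairsCovered)
  where
  open import Algebra.Lattice.Properties.BooleanAlgebra (∪-∩-booleanAlgebra n)
    using (¬-involutive)

  covered : subsetsOfSize n k ⊆ₗ E ++ map ∁ E
  covered {A} A∈S with A ∈ˢ? E | ∁ A ∈ˢ? E
  ... | yes A∈E | _        = ∈-++⁺ˡ A∈E
  ... | no _    | yes ∁A∈E = ∈-++⁺ʳ E (subst (_∈ map ∁ E) (¬-involutive A) (∈-map⁺ ∁ ∁A∈E))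
  ... | no A∉E  | no ∁A∉E  = contradiction (lose A∈S (A∉E , ∁A∉E)) none

  pairsCovered : n C k ≤ length E * 2
  pairsCovered = begin
    n C k                      ≡⟨ length-subsetsOfSize n k ⟨
    length (subsetsOfSize n k) ≤⟨ Unique∧⊆⇒length≤ (subsetsOfSize-unique n k) covered ⟩
    length (E ++ map ∁ E)      ≡⟨ length-++ E ⟩
    length E + length (map ∁ E) ≡⟨ cong (length E +_) (length-map ∁ E) ⟩
    length E + length E        ≡⟨ cong (length E +_) (+-identityʳ (length E)) ⟨
    2 * length E               ≡⟨ *-comm 2 (length E) ⟩
    length E * 2               ∎
    where open ≤-Reasoning

∣p∣≡∣q∣∧p≢q⇒∃∈p∉q : ∀ {n} {p q : Subset n} → ∣ p ∣ ≡ ∣ q ∣ → p ≢ q → ∃ λ x → x ∈ₛ p × x ∉ₛ q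
∣p∣≡∣q∣∧p≢q⇒∃∈p∉q {p = p} {q} ∣p∣≡∣q∣ p≢q with Fin.any? (λ x → x ∈? p ×-dec ¬? (x ∈? q))
... | yes witness = witness
... | no none = contradiction (⊆-antisym p⊆q q⊆p) p≢q
  where
  p⊆q : p ⊆ q
  p⊆q {x} x∈p = decidable-stable (x ∈? q) (λ x∉q → none (x , x∈p , x∉q))
  q⊆p : q ⊆ p
  q⊆p {x} x∈q = decidable-stable (x ∈? p) λ x∉p →
    <-irrefl ∣p∣≡∣q∣ (p⊂q⇒∣p∣<∣q∣ (p⊆q , x , x∈q , x∉p))

∣p∣≡n⇒∣∁p∣≡n : ∀ {n} (p : Subset (2 * n)) → ∣ p ∣ ≡ n → ∣ ∁ p ∣ ≡ n
∣p∣≡n⇒∣∁p∣≡n {n} p ∣p∣≡n = begin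
  ∣ ∁ p ∣          ≡⟨ ∣∁p∣≡n∸∣p∣ p ⟩
  2 * n ∸ ∣ p ∣    ≡⟨ cong (2 * n ∸_) ∣p∣≡n ⟩
  n + (n + 0) ∸ n  ≡⟨ m+n∸m≡n n (n + 0) ⟩
  n + 0            ≡⟨ +-identityʳ n ⟩
  n                ∎
  where open ≡-Reasoning

∈-elems⁺ : ∀ {n} {e : Subset n} {v} → v ∈ₛ e → v ∈ elems e
∈-elems⁺ {e = e} {v} v∈e = ∈-filter⁺ (_∈? e) (∈-allFin v) v∈e

∈-elems⁻ : ∀ {n} {e : Subset n} {v} → v ∈ elems e → v ∈ₛ e
∈-elems⁻ {e = e} v∈e = proj₂ (∈-filter⁻ (_∈? e) {xs = allFin _} v∈e)

numColors≡length : ∀ {n} (f : Fin n → ℕ) (e : Subset n) {cs : List ℕ} → Unique cs →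
                   (∀ {v} → v ∈ₛ e → f v ∈ cs) → (∀ {c} → c ∈ cs → ∃ λ v → v ∈ₛ e × f v ≡ c) →
                   numColors f e ≡ length cs
numColors≡length f e uniqueCs colours⊆cs cs⊆colours =
  Unique∧⊆∧⊇⇒length≡ (deduplicate-! (map f (elems e))) uniqueCs colours⊆cs′ cs⊆colours′
  where
  colours⊆cs′ : deduplicate _≟_ (map f (elems e)) ⊆ₗ _
  colours⊆cs′ c∈colours with ∈-map⁻ f (∈-deduplicate⁻ _≟_ (map f (elems e)) c∈colours)
  ... | v , v∈e , refl = colours⊆cs (∈-elems⁻ v∈e)
  cs⊆colours′ : _ ⊆ₗ deduplicate _≟_ (map f (elems e))
  cs⊆colours′ c∈cs with cs⊆colours c∈cs
  ... | v , v∈e , refl = ∈-deduplicate⁺ _≟_ (∈-map⁺ f (∈-elems⁺ v∈e))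

twoColouring : ∀ {n} → Subset n → Fin n → ℕ
twoColouring A v with v ∈? A
... | yes _ = 0
... | no  _ = 1

module _ {n} {A : Subset n} where

  twoColouring-∈ : ∀ {v} → v ∈ₛ A → twoColouring A v ≡ 0
  twoColouring-∈ {v} v∈A with v ∈? A
  ... | yes _   = refl
  ... | no  v∉A = contradiction v∈A v∉A

  twoColouring-∉ : ∀ {v} → v ∉ₛ A → twoColouring A v ≡ 1
  twoColouring-∉ {v} v∉A with v ∈? A
  ... | yes v∈A = contradiction v∈A v∉A
  ... | no  _   = refl

  twoColouring-∈01 : ∀ v → twoColouring A v ∈ 0 ∷ 1 ∷ []
  twoColouring-∈01 v with v ∈? A
  ... | yes _ = here refl
  ... | no  _ = there (here refl)

  numColors-twoColouring : ∀ {e x y} → x ∈ₛ e → x ∈ₛ A → y ∈ₛ e → y ∉ₛ A →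
                           numColors (twoColouring A) e ≡ 2
  numColors-twoColouring {e} {x} {y} x∈e x∈A y∈e y∉A =
    numColors≡length (twoColouring A) e (((λ ()) All.∷ All.[]) ∷ (All.[] ∷ []))
      (λ {v} _ → twoColouring-∈01 v) bothColoursOccur
    where
    bothColoursOccur : ∀ {c} → c ∈ 0 ∷ 1 ∷ [] → ∃ λ v → v ∈ₛ e × twoColouring A v ≡ c
    bothColoursOccur (here refl)         = x , x∈e , twoColouring-∈ x∈A
    bothColoursOccur (there (here refl)) = y , y∈e , twoColouring-∉ y∉A

lemma2p3 : (r : ℕ) → 3 ≤ r → (H : BiHypergraph (2 * r)) → Uniform r H →
    numEdges H * 2 < (2 * r) C r → Colorable H
lemma2p3 r 3≤r H uniform fewEdges
  with A , ∣A∣≡r , A∉E , ∁A∉E ← ∃-complementary-pair-∉ r (edges H) fewEdges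
  = twoColouring A , All.tabulate proper
  where
  edge⊈ : ∀ {e} (B : Subset (2 * r)) → ∣ B ∣ ≡ r → B ∉ edges H → e ∈ edges H →
          ∃ λ x → x ∈ₛ e × x ∉ₛ B
  edge⊈ B ∣B∣≡r B∉E e∈E =
    ∣p∣≡∣q∣∧p≢q⇒∃∈p∉q (trans (All.lookup uniform e∈E) (sym ∣B∣≡r)) (λ { refl → B∉E e∈E })

  bichromatic : ∀ {e} → e ∈ edges H → numColors (twoColouring A) e ≡ 2
  bichromatic e∈E
    with x , x∈e , x∉∁A ← edge⊈ (∁ A) (∣p∣≡n⇒∣∁p∣≡n A ∣A∣≡r) ∁A∉E e∈E
       | y , y∈e , y∉A  ← edge⊈ A ∣A∣≡r A∉E e∈E
    = numColors-twoColouring x∈e (x∉∁p⇒x∈p x∉∁A) y∈e y∉A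

  proper : ∀ {e} → e ∈ edges H →
           1 < numColors (twoColouring A) e × numColors (twoColouring A) e < ∣ e ∣
  proper e∈E rewrite bichromatic e∈E | All.lookup uniform e∈E = s≤s (s≤s z≤n) , 3≤r
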